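{- Let $G$ be a saturable graph with diameter at most $2$. Then $G$ is supersaturable.
   Context: For a finite graph $G$ and a positive integer $k$, a proper $k$-total difference labeling (TDL) of $G$ is a function $f$ from $V(G)\cup E(G)$ to $\{1,2,\dots,k\}$ such that: (1) for every edge $\{u,v\}$, $f(\{u,v\})=|f(u)-f(v)|$; (2) adjacent vertices receive different labels; (3) two edges sharing a vertex receive different labels; (4) no edge receives the same label as one of its endpoints. $\chi_{td}(G)$ denotes the smallest $k$ for which $G$ has a proper $k$-TDL. If $G$ has order $n$, a TDL of $G$ is saturated if $\chi_{td}(G)=n$ and the set of vertex labels used is exactly $\{1,2,\dots,\chi_{td}(G)\}$. A graph is saturable if it has at least one saturated labeling, and supersaturable if every proper $\chi_{td}(G)$-TDL of it is a saturated labeling. -}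

module Defs where

open import Data.Nat using (ℕ; _≤_; ∣_-_∣)
open import Data.Fin using (Fin)
open import Data.Product using (Σ; ∃; _×_)
open import Data.Sum using (_⊎_)
open import Relation.Binary.PropositionalEquality using (_≡_; _≢_)
open import Relation.Nullary using (¬_)

record Graph (n : ℕ) : Set₁ where
  field
    Adj    : Fin n → Fin n → Set
    sym    : ∀ {u v} → Adj u v → Adj v u
    irrefl : ∀ {u} → ¬ Adj u u
open Graph public

module _ {n : ℕ} (G : Graph n) where

  DiameterAtMost2 : Set
  DiameterAtMost2 = ∀ u v → u ≢ v → Adj G u v ⊎ (∃ λ w → Adj G u w × Adj G w v)

  -- A proper k-total difference labeling.  It is determined by the vertex
  -- labels f; the label of edge {u,v} is  ∣ f u - f v ∣  (condition (1)).
  record ProperTDL (k : ℕ) (f : Fin n → ℕ) : Set where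
    field
      vertexRange : ∀ v → 1 ≤ f v × f v ≤ k
      edgeRange   : ∀ u v → Adj G u v → 1 ≤ ∣ f u - f v ∣ × ∣ f u - f v ∣ ≤ k
      adjDistinct : ∀ u v → Adj G u v → f u ≢ f v
      edgeDistinct : ∀ u v w → Adj G u v → Adj G u w → v ≢ w →
                     ∣ f u - f v ∣ ≢ ∣ f u - f w ∣
      edgeVertexDistinct : ∀ u v → Adj G u v → ∣ f u - f v ∣ ≢ f u

  HasTDL : ℕ → Set
  HasTDL k = ∃ λ f → ProperTDL k f

  IsChiTD : ℕ → Set
  IsChiTD k = HasTDL k × (∀ j → HasTDL j → k ≤ j)

  Saturated : ℕ → (Fin n → ℕ) → Set
  Saturated k f = IsChiTD k × ProperTDL k f × k ≡ n ×
                  (∀ i → 1 ≤ i → i ≤ k → ∃ λ v → f v ≡ i)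

  Saturable : Set
  Saturable = ∃ λ k → ∃ λ f → Saturated k f

  Supersaturable : Set
  Supersaturable = ∀ k → IsChiTD k → ∀ f → ProperTDL k f → Saturated k f

-- In a graph of diameter at most 2 any two distinct vertices u, v are adjacent
-- or have a common neighbour w; rule (2) in the first case, and rule (3) at w
-- in the second, forbid f u = f v.  So every proper TDL is injective on the
-- vertices.  A saturated labeling forces χ_td(G) = n, so every proper
-- χ_td(G)-TDL injects the n vertices into {1,…,n}, hence is onto it.
module Submission where

open import Defs
open import Data.Nat using (ℕ; suc; _≤_; ∣_-_∣)
open import Data.Nat.Properties using (≤-antisym; <-irrefl)
open import Data.Fin using (Fin; fromℕ<; punchOut)
open import Data.Fin.Properties using (_≟_; any?; fromℕ<-injective; punchOut-injective; injective⇒≤)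
open import Data.Product using (∃; _×_; _,_; proj₁; proj₂)
open import Data.Sum using (inj₁; inj₂)
open import Function using (_∘_)
open import Function.Definitions using (Injective)
open import Relation.Nullary using (yes; no; contradiction)
open import Relation.Binary.PropositionalEquality
  using (_≡_; _≢_; ≢-sym; refl; cong)

injective⇒surjective : ∀ {n} {f : Fin n → Fin n} → Injective _≡_ _≡_ f →
                       ∀ i → ∃ λ v → f v ≡ i
injective⇒surjective {suc m} {f} f-inj i with any? (λ v → f v ≟ i)
... | yes hit = hit
... | no ¬hit = contradiction (injective⇒≤ punchOut∘f-inj) (<-irrefl refl)
  where
  i≢f : ∀ v → i ≢ f v
  i≢f v = ≢-sym (¬hit ∘ (v ,_))

  punchOut∘f-inj : Injective _≡_ _≡_ (λ v → punchOut (i≢f v))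
  punchOut∘f-inj = f-inj ∘ punchOut-injective (i≢f _) (i≢f _)

label⇒Fin : ∀ {ℓ n} → 1 ≤ ℓ → ℓ ≤ n → Fin n
label⇒Fin {suc ℓ} _ ℓ<n = fromℕ< ℓ<n

label⇒Fin-injective : ∀ {ℓ ℓ′ n} (1≤ℓ : 1 ≤ ℓ) (ℓ≤n : ℓ ≤ n)
                      (1≤ℓ′ : 1 ≤ ℓ′) (ℓ′≤n : ℓ′ ≤ n) →
                      label⇒Fin 1≤ℓ ℓ≤n ≡ label⇒Fin 1≤ℓ′ ℓ′≤n → ℓ ≡ ℓ′
label⇒Fin-injective {suc ℓ} {suc ℓ′} _ ℓ<n _ ℓ′<n eq =
  cong suc (fromℕ<-injective ℓ ℓ′ ℓ<n ℓ′<n eq)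

injective-labels-cover : ∀ {n} (f : Fin n → ℕ) → (∀ v → 1 ≤ f v × f v ≤ n) →
                         Injective _≡_ _≡_ f → ∀ i → 1 ≤ i → i ≤ n → ∃ λ v → f v ≡ i
injective-labels-cover {n} f range f-inj i 1≤i i≤n =
  let v , code-v≡i = injective⇒surjective code-injective (label⇒Fin 1≤i i≤n)
  in  v , label⇒Fin-injective (proj₁ (range v)) (proj₂ (range v)) 1≤i i≤n code-v≡i
  where
  code : Fin n → Fin n
  code v = label⇒Fin (proj₁ (range v)) (proj₂ (range v))

  code-injective : Injective _≡_ _≡_ code
  code-injective {u} {v} = f-inj ∘ label⇒Fin-injective (proj₁ (range u)) (proj₂ (range u))
                                                       (proj₁ (range v)) (proj₂ (range v))

module _ {n : ℕ} (G : Graph n) where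

  diameter≤2⇒TDL-injective : DiameterAtMost2 G → ∀ {k f} → ProperTDL G k f →
                             Injective _≡_ _≡_ f
  diameter≤2⇒TDL-injective diam {f = f} P {u} {v} fu≡fv with u ≟ v
  ... | yes u≡v = u≡v
  ... | no u≢v with diam u v u≢v
  ...   | inj₁ u~v = contradiction fu≡fv (ProperTDL.adjDistinct P u v u~v)
  ...   | inj₂ (w , u~w , w~v) =
          contradiction (cong (λ x → ∣ f w - x ∣) fu≡fv)
                        (ProperTDL.edgeDistinct P w u v (Graph.sym G u~w) w~v u≢v)

  IsChiTD-unique : ∀ {j k} → IsChiTD G j → IsChiTD G k → j ≡ k
  IsChiTD-unique (hasTDL-j , j-least) (hasTDL-k , k-least) =
    ≤-antisym (j-least _ hasTDL-k) (k-least _ hasTDL-j)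

mainTheorem12 : (n : ℕ) (G : Graph n) → Saturable G → DiameterAtMost2 G →
    Supersaturable G
mainTheorem12 n G (_ , _ , chi-k₀ , _ , refl , _) diam k chi-k f P
  with refl ← IsChiTD-unique G chi-k chi-k₀
  = chi-k , P , refl ,
    injective-labels-cover f (ProperTDL.vertexRange P) (diameter≤2⇒TDL-injective G diam P)
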